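{- Let \(T\) be a graph with tree-width \(2\), and let \(\vec T\) be an orientation of \(T\). Then \(\vec T\) is complete convex if and only if \(T\) is a \(2\)-tree and every induced copy of \(K_3\) in \(T\) is a directed \(3\)-cycle in \(\vec T\).
   Context: Graphs are connected with at least two vertices and no parallel edges. In an oriented graph, \(u,v,w\) is a \(2\)-dipath with centre \(v\) if \(uv,vw\) are arcs, \(u\ne v\), \(v\ne w\). A vertex set \(S\) is convex if no vertex outside \(S\) is the centre of a \(2\)-dipath with both ends in \(S\); \(conv(S)\) is the smallest convex set containing \(S\), and \(conv(uv)=conv(\{u,v\})\). An oriented graph is complete convex if \(conv(uv)\) is the whole vertex set for every arc \(uv\). -}

module Defs where

open import Data.Nat using (ℕ; zero; suc; _≤_; _<_)
open import Data.Bool using (Bool; true; false)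
open import Data.Fin using (Fin; toℕ; inject₁; fromℕ) renaming (zero to fzero; suc to fsuc)
open import Data.Fin.Subset using (Subset; _∈_; _⊆_; ⁅_⁆; _∪_; ∣_∣)
open import Data.Fin.Permutation using (Permutation′; _⟨$⟩ʳ_)
open import Data.Product using (Σ; ∃; _×_; _,_)
open import Data.Sum using (_⊎_)
open import Data.Empty using (⊥)
open import Relation.Nullary using (¬_)
open import Relation.Binary.PropositionalEquality using (_≡_; _≢_)
open import Relation.Binary.Construct.Closure.ReflexiveTransitive using (Star)
open import Function.Definitions using (Injective)

record Graph (n : ℕ) : Set where
  field
    adj   : Fin n → Fin n → Bool
    irrefl : ∀ v → adj v v ≡ false
    sym    : ∀ u v → adj u v ≡ adj v u

Edge : ∀ {n} → Graph n → Fin n → Fin n → Set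
Edge G u v = Graph.adj G u v ≡ true

Connected : ∀ {n} → Graph n → Set
Connected {n} G = ∀ (u v : Fin n) → Star (Edge G) u v

record Cycle {n} (G : Graph n) : Set where
  field
    k     : ℕ
    c     : Fin (suc (suc (suc k))) → Fin n
    inj   : Injective _≡_ _≡_ c
    step  : ∀ (i : Fin (suc (suc k))) → Edge G (c (inject₁ i)) (c (fsuc i))
    close : Edge G (c (fromℕ (suc (suc k)))) (c fzero)

Acyclic : ∀ {n} → Graph n → Set
Acyclic G = ¬ Cycle G

IsTree : ∀ {n} → Graph n → Set
IsTree G = Connected G × Acyclic G

record TreeDecomposition {n} (G : Graph n) : Set where
  field
    m      : ℕ
    tree   : Graph m
    isTree : IsTree tree
    bag    : Fin m → Subset n
    vertexCover : ∀ (v : Fin n) → ∃ λ t → v ∈ bag t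
    edgeCover   : ∀ (u v : Fin n) → Edge G u v → ∃ λ t → (u ∈ bag t × v ∈ bag t)
    -- the bags containing v induce a connected subtree
    coherent    : ∀ (v : Fin n) (t t′ : Fin m) → v ∈ bag t → v ∈ bag t′ →
                  Star (λ a b → Edge tree a b × v ∈ bag a × v ∈ bag b) t t′

-- width of a decomposition is (max bag size) - 1
HasWidthAtMost : ∀ {n} {G : Graph n} → TreeDecomposition G → ℕ → Set
HasWidthAtMost D k = ∀ t → ∣ TreeDecomposition.bag D t ∣ ≤ suc k

TreeWidth≤ : ∀ {n} → Graph n → ℕ → Set
TreeWidth≤ G k = Σ (TreeDecomposition G) λ D → HasWidthAtMost D k

TreeWidth≡ : ∀ {n} → Graph n → ℕ → Set
TreeWidth≡ G zero    = TreeWidth≤ G zero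
TreeWidth≡ G (suc k) = TreeWidth≤ G (suc k) × ¬ TreeWidth≤ G k

-- 2-trees: obtained from K₃ by repeatedly adding a new vertex adjacent
-- to both ends of an existing edge.  Expressed via the construction
-- order σ (σ 0, σ 1, σ 2 form the initial K₃; vertex σ i, i ≥ 3, is
-- added adjacent to exactly the two adjacent earlier vertices σ j, σ l).

Is2Tree : ∀ {n} → Graph n → Set
Is2Tree {n} G = 3 ≤ n × Σ (Permutation′ n) λ σ →
  (∀ (i j : Fin n) → toℕ i < 3 → toℕ j < 3 → i ≢ j → Edge G (σ ⟨$⟩ʳ i) (σ ⟨$⟩ʳ j)) ×
  (∀ (i : Fin n) → 3 ≤ toℕ i → Σ (Fin n) λ j → Σ (Fin n) λ l →
     toℕ j < toℕ i × toℕ l < toℕ i × j ≢ l × Edge G (σ ⟨$⟩ʳ j) (σ ⟨$⟩ʳ l) ×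
     (∀ (p : Fin n) → toℕ p < toℕ i →
        (Edge G (σ ⟨$⟩ʳ i) (σ ⟨$⟩ʳ p) → (p ≡ j ⊎ p ≡ l)) ×
        ((p ≡ j ⊎ p ≡ l) → Edge G (σ ⟨$⟩ʳ i) (σ ⟨$⟩ʳ p))))

record Orientation {n} (G : Graph n) : Set where
  field
    arc     : Fin n → Fin n → Bool
    arc⇒edge : ∀ u v → arc u v ≡ true → Edge G u v
    edge⇒arc : ∀ u v → Edge G u v → arc u v ≡ true ⊎ arc v u ≡ true
    antisym  : ∀ u v → arc u v ≡ true → arc v u ≡ true → ⊥

Arc : ∀ {n} {G : Graph n} → Orientation G → Fin n → Fin n → Set
Arc O u v = Orientation.arc O u v ≡ true

Convex : ∀ {n} {G : Graph n} → Orientation G → Subset n → Set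
Convex {n} O S = ∀ (u v w : Fin n) → u ≢ v → v ≢ w →
  Arc O u v → Arc O v w → u ∈ S → w ∈ S → v ∈ S

_∈conv_ : ∀ {n} {G : Graph n} {O : Orientation G} → Fin n → Subset n → Set
_∈conv_ {n} {G} {O} x S = ∀ (C : Subset n) → Convex O C → S ⊆ C → x ∈ C

CompleteConvex : ∀ {n} {G : Graph n} → Orientation G → Set
CompleteConvex {n} {G} O = ∀ (u v : Fin n) → Arc O u v →
  ∀ (x : Fin n) → _∈conv_ {O = O} x (⁅ u ⁆ ∪ ⁅ v ⁆)

TrianglesDirected : ∀ {n} {G : Graph n} → Orientation G → Set
TrianglesDirected {n} {G} O = ∀ (a b c : Fin n) →
  Edge G a b → Edge G b c → Edge G a c →
  (Arc O a b × Arc O b c × Arc O c a) ⊎ (Arc O a c × Arc O c b × Arc O b a)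

module Submission where

-- A graph of tree-width at most 2 is 2-degenerate in a strong sense: every nonempty vertex set S has a
-- vertex x whose neighbours in S all lie in one bag of a width-2 decomposition, so x has at most two
-- neighbours in S. If the orientation induced on S is complete convex and |S| ≥ 3, then the hull of an
-- arc avoiding x contains x, so x is the centre of a 2-dipath a → x → b; these are all the neighbours of
-- x in S, and the hull of the arc a → x contains b, which forces b → a. Deleting x keeps the induced
-- orientation complete convex, so peeling off such vertices one at a time exhibits T as a 2-tree all of
-- whose triangles are directed. Conversely, if the triangles of a 2-tree are directed, a convex set
-- containing two vertices of a triangle contains the third. A convex set containing an arc therefore
-- contains the initial triangle, by descending along the construction order, and then every vertex, by
-- climbing it back up.

open import Defs
open import Data.Nat using (ℕ; zero; suc; _+_; _∸_; _≤_; _<_; z≤n; s≤s; _≤?_; _≟_)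
open import Data.Nat.Properties
  using ( ≤-refl; ≤-reflexive; ≤-trans; <-trans; <-≤-trans; ≤-<-trans; ≤-pred; <-irrefl; <-cmp; <⇒≢; <⇒≱; <⇒≤; ≰⇒>
        ; m≤n⇒m<n∨m≡n; m≤n⇒m≤1+n; n≤1+n; m≤n+m; +-suc; +-identityʳ; +-monoˡ-≤; suc-injective; m+[n∸m]≡n)
open import Data.Bool using (true; false)
import Data.Bool.Properties as Bool
open import Data.Fin using (Fin; toℕ; inject₁; fromℕ; fromℕ<) renaming (zero to fzero; suc to fsuc)
open import Data.Fin.Properties using (any?; pigeonhole; toℕ-injective; toℕ-fromℕ<; toℕ<n)
  renaming (_≟_ to _≟ᶠ_; <⇒≢ to <⇒≢ᶠ)
open import Data.Fin.Subset as Subset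
  using (Subset; _∈_; _∉_; _⊆_; _∪_; ⁅_⁆; _-_; ∣_∣; Nonempty; inside; outside)
open import Data.Fin.Subset.Properties
  using ( _∈?_; ∈⊤; ∣⊤∣≡n; x∈⁅x⁆; x∈⁅y⁆⇒x≡y; x∈p∪q⁺; x∈p∪q⁻; p─⊥≡p; p─q⊆p; x∈p∧x≢y⇒x∈p-y
        ; x∈p⇒∣p-x∣<∣p∣; nonempty?; Empty-unique; ∣⊥∣≡0)
open import Data.Fin.Permutation using (Permutation′; permutation; _⟨$⟩ʳ_; _⟨$⟩ˡ_; inverseʳ)
open import Data.Vec using (_∷_; here; there; tabulate)
open import Data.Vec.Properties using (lookup∘tabulate; []=⇒lookup; lookup⇒[]=)
open import Data.List using (List; []; _∷_; _++_; [_]; length; lookup; drop)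
open import Data.List.Properties using (length-++)
open import Data.List.Relation.Unary.All as All using (All; []; _∷_)
open import Data.List.Relation.Unary.All.Properties using (¬Any⇒All¬; ++⁻ˡ; ++⁻ʳ; drop⁺)
open import Data.List.Relation.Unary.AllPairs using ([]; _∷_)
open import Data.List.Relation.Unary.Linked as Linked using (Linked; []; [-]; _∷_)
open import Data.List.Relation.Unary.Unique.Propositional using (Unique)
open import Data.List.Membership.Propositional using () renaming (_∉_ to _∉ₗ_)
open import Data.List.Membership.Propositional.Properties using (∈-lookup; ∈-∃++)
open import Data.Product using (Σ; ∃-syntax; _×_; _,_; proj₁; proj₂; uncurry)
open import Data.Sum as Sum using (_⊎_; inj₁; inj₂; [_,_]′)
open import Data.Unit using (⊤; tt)
open import Function using (_∘_)
open import Function.Bundles using (_⇔_; mk⇔)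
open import Relation.Nullary using (¬_; Dec; yes; no; does; contradiction)
open import Relation.Nullary.Decidable
  using (_×-dec_; _⊎-dec_; _→-dec_; ¬?; decidable-stable; dec-true; dec-false)
open import Relation.Unary using (Decidable)
open import Relation.Binary.Definitions using (tri<; tri≈; tri>)
open import Relation.Binary.PropositionalEquality
  using (_≡_; _≢_; refl; sym; trans; cong; subst; subst₂; ≢-sym)
open import Relation.Binary.Construct.Closure.ReflexiveTransitive using (Star; ε; _◅_)

private variable
  A  : Set
  n  : ℕ
  xs : List A

x∉p-x : ∀ (x : Fin n) (p : Subset n) → x ∉ p - x
x∉p-x (fsuc x) (_ ∷ p) (there x∈p-x) = x∉p-x x p x∈p-x

x∈p-y⇒x≢y : ∀ {p : Subset n} {x y} → x ∈ p - y → x ≢ y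
x∈p-y⇒x≢y {p = p} {x} x∈p-x refl = x∉p-x x p x∈p-x

x∈p-y⇒x∈p : ∀ {p : Subset n} {x y} → x ∈ p - y → x ∈ p
x∈p-y⇒x∈p = p─q⊆p _ _

∣p∣≡1+∣p-x∣ : ∀ {p : Subset n} {x} → x ∈ p → ∣ p ∣ ≡ suc ∣ p - x ∣
∣p∣≡1+∣p-x∣ {p = inside ∷ p}  here        = cong suc (cong ∣_∣ (sym (p─⊥≡p p)))
∣p∣≡1+∣p-x∣ {p = inside ∷ p}  (there x∈p) = cong suc (∣p∣≡1+∣p-x∣ x∈p)
∣p∣≡1+∣p-x∣ {p = outside ∷ p} (there x∈p) = ∣p∣≡1+∣p-x∣ x∈p

∣p∣>0⇒nonempty : ∀ {n} {p : Subset n} → 0 < ∣ p ∣ → Nonempty p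
∣p∣>0⇒nonempty {n} {p} 0<∣p∣ with nonempty? p
... | yes nonempty = nonempty
... | no  empty    = contradiction (trans (cong ∣_∣ (Empty-unique empty)) (∣⊥∣≡0 n)) (≢-sym (<⇒≢ 0<∣p∣))

four-elements⇒4≤∣p∣ : ∀ {n} {p : Subset n} {a b c d} → a ∈ p → b ∈ p → c ∈ p → d ∈ p →
                       a ≢ b → a ≢ c → a ≢ d → b ≢ c → b ≢ d → c ≢ d → 4 ≤ ∣ p ∣
four-elements⇒4≤∣p∣ {n} {p} {a} {b} {c} {d} a∈p b∈p c∈p d∈p a≢b a≢c a≢d b≢c b≢d c≢d =
  remove a∈p (remove b∈p-a (remove c∈p-a-b (remove d∈p-a-b-c z≤n)))
  where
  remove : ∀ {k} {q : Subset n} {z} → z ∈ q → k ≤ ∣ q - z ∣ → suc k ≤ ∣ q ∣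
  remove z∈q k≤∣q-z∣ = ≤-trans (s≤s k≤∣q-z∣) (x∈p⇒∣p-x∣<∣p∣ z∈q)
  b∈p-a : b ∈ p - a
  b∈p-a = x∈p∧x≢y⇒x∈p-y b∈p (≢-sym a≢b)
  c∈p-a-b : c ∈ p - a - b
  c∈p-a-b = x∈p∧x≢y⇒x∈p-y (x∈p∧x≢y⇒x∈p-y c∈p (≢-sym a≢c)) (≢-sym b≢c)
  d∈p-a-b-c : d ∈ p - a - b - c
  d∈p-a-b-c = x∈p∧x≢y⇒x∈p-y (x∈p∧x≢y⇒x∈p-y (x∈p∧x≢y⇒x∈p-y d∈p (≢-sym a≢d)) (≢-sym b≢d)) (≢-sym c≢d)

∣p∣≤3⇒one-of-three : ∀ {p : Subset n} {a b c d} → ∣ p ∣ ≤ 3 → a ∈ p → b ∈ p → c ∈ p →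
                     a ≢ b → a ≢ c → b ≢ c → d ∈ p → d ≡ a ⊎ d ≡ b ⊎ d ≡ c
∣p∣≤3⇒one-of-three {a = a} {b} {c} {d} ∣p∣≤3 a∈p b∈p c∈p a≢b a≢c b≢c d∈p with d ≟ᶠ a | d ≟ᶠ b | d ≟ᶠ c
... | yes d≡a | _       | _       = inj₁ d≡a
... | no _    | yes d≡b | _       = inj₂ (inj₁ d≡b)
... | no _    | no _    | yes d≡c = inj₂ (inj₂ d≡c)
... | no d≢a  | no d≢b  | no d≢c  = contradiction ∣p∣≤3 (<⇒≱ (four-elements⇒4≤∣p∣ a∈p b∈p c∈p d∈p
                                      a≢b a≢c (≢-sym d≢a) b≢c (≢-sym d≢b) (≢-sym d≢c)))

3≤∣p∣⇒third-element : ∀ {p : Subset n} {x y} → 3 ≤ ∣ p ∣ → x ∈ p → y ∈ p → x ≢ y →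
                      ∃[ z ] z ∈ p × z ≢ x × z ≢ y
3≤∣p∣⇒third-element {p = p} {x} {y} 3≤∣p∣ x∈p y∈p x≢y
  with ∣p∣>0⇒nonempty (≤-pred (≤-pred (subst (3 ≤_) ∣p∣≡2+∣p-x-y∣ 3≤∣p∣)))
  where
  ∣p∣≡2+∣p-x-y∣ : ∣ p ∣ ≡ suc (suc ∣ p - x - y ∣)
  ∣p∣≡2+∣p-x-y∣ = trans (∣p∣≡1+∣p-x∣ x∈p) (cong suc (∣p∣≡1+∣p-x∣ (x∈p∧x≢y⇒x∈p-y y∈p (≢-sym x≢y))))
... | z , z∈p-x-y = z , x∈p-y⇒x∈p z∈p-x , x∈p-y⇒x≢y z∈p-x , x∈p-y⇒x≢y {p = p - x} z∈p-x-y
  where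
  z∈p-x : z ∈ p - x
  z∈p-x = x∈p-y⇒x∈p {y = y} z∈p-x-y

toSubset : ∀ {C : Fin n → Set} → Decidable C → Subset n
toSubset C? = tabulate (does ∘ C?)

∈-toSubset⁺ : ∀ {C : Fin n → Set} (C? : Decidable C) {z} → C z → z ∈ toSubset C?
∈-toSubset⁺ C? {z} Cz = lookup⇒[]= z _ (trans (lookup∘tabulate (does ∘ C?) z) (dec-true (C? z) Cz))

∈-toSubset⁻ : ∀ {C : Fin n → Set} (C? : Decidable C) {z} → z ∈ toSubset C? → C z
∈-toSubset⁻ C? {z} z∈C =
  decidable-stable (C? z) λ ¬Cz → contradiction (trans (sym does≡true) (dec-false (C? z) ¬Cz)) λ ()
  where
  does≡true : does (C? z) ≡ true
  does≡true = trans (sym (lookup∘tabulate (does ∘ C?) z)) ([]=⇒lookup z∈C)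

Edge-sym : ∀ (G : Graph n) {u v} → Edge G u v → Edge G v u
Edge-sym G {u} {v} u—v = trans (Graph.sym G v u) u—v

Edge⇒≢ : ∀ (G : Graph n) {u v} → Edge G u v → u ≢ v
Edge⇒≢ G {u} u—u refl = contradiction (trans (sym (Graph.irrefl G u)) u—u) λ ()

K₁ : Graph 1
K₁ = record { adj = λ _ _ → false ; irrefl = λ _ → refl ; sym = λ _ _ → refl }

treeWidth≤1-of-two-vertices : (T : Graph 2) → TreeWidth≤ T 1
treeWidth≤1-of-two-vertices T = record
  { m           = 1
  ; tree        = K₁
  ; isTree      = (λ { fzero fzero → ε }) , (λ cycle → contradiction (Cycle.step cycle fzero) λ ())
  ; bag         = λ _ → Subset.⊤
  ; vertexCover = λ _ → fzero , ∈⊤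
  ; edgeCover   = λ _ _ _ → fzero , ∈⊤ , ∈⊤
  ; coherent    = λ { _ fzero fzero _ _ → ε }
  } , λ _ → ≤-refl

treeWidth≰1⇒3≤n : ∀ {n} (T : Graph n) → 2 ≤ n → ¬ TreeWidth≤ T 1 → 3 ≤ n
treeWidth≰1⇒3≤n {1}                 _ (s≤s ())
treeWidth≰1⇒3≤n {2}                 T _ width≰1 = contradiction (treeWidth≤1-of-two-vertices T) width≰1
treeWidth≰1⇒3≤n {suc (suc (suc _))} _ _ _       = s≤s (s≤s (s≤s z≤n))

-- Non-backtracking walks in acyclic graphs

NonBacktracking : List A → Set
NonBacktracking (x ∷ y ∷ z ∷ xs) = x ≢ z × NonBacktracking (y ∷ z ∷ xs)
NonBacktracking _                = ⊤

NonBacktracking-tail : ∀ {x : A} xs → NonBacktracking (x ∷ xs) → NonBacktracking xs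
NonBacktracking-tail []          _        = tt
NonBacktracking-tail (_ ∷ [])    _        = tt
NonBacktracking-tail (_ ∷ _ ∷ _) (_ , nb) = nb

module _ {R : A → A → Set} where

  Linked-++⁻ˡ : ∀ {ys} xs → Linked R (xs ++ ys) → Linked R xs
  Linked-++⁻ˡ []           _       = []
  Linked-++⁻ˡ (_ ∷ [])     _       = [-]
  Linked-++⁻ˡ (_ ∷ x ∷ xs) (r ∷ l) = r ∷ Linked-++⁻ˡ (x ∷ xs) l

  Linked-++-∷⁻ : ∀ {y ys} xs → Linked R (xs ++ y ∷ ys) → Linked R (xs ++ [ y ])
  Linked-++-∷⁻ []           _       = [-]
  Linked-++-∷⁻ (_ ∷ [])     (r ∷ _) = r ∷ [-]
  Linked-++-∷⁻ (_ ∷ x ∷ xs) (r ∷ l) = r ∷ Linked-++-∷⁻ (x ∷ xs) l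

  Linked-lookup : ∀ {x y} → Linked R (x ∷ y ∷ xs) →
                  ∀ i → R (lookup (x ∷ y ∷ xs) (inject₁ i)) (lookup (x ∷ y ∷ xs) (fsuc i))
  Linked-lookup              (r ∷ _) fzero    = r
  Linked-lookup {xs = _ ∷ _} (_ ∷ l) (fsuc i) = Linked-lookup l i

  Linked-last : ∀ {y z} xs → Linked R (y ∷ xs ++ [ z ]) → R (lookup (y ∷ xs) (fromℕ (length xs))) z
  Linked-last []       (r ∷ _) = r
  Linked-last (_ ∷ xs) (_ ∷ l) = Linked-last xs l

lookup-injective : Unique xs → ∀ {i j} → lookup xs i ≡ lookup xs j → i ≡ j
lookup-injective (_    ∷ _) {fzero}  {fzero}  _ = refl
lookup-injective (x∉xs ∷ _) {fzero}  {fsuc j} e = contradiction e (All.lookup x∉xs (∈-lookup j))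
lookup-injective (x∉xs ∷ _) {fsuc i} {fzero}  e = contradiction (sym e) (All.lookup x∉xs (∈-lookup i))
lookup-injective (_    ∷ u) {fsuc i} {fsuc j} e = cong fsuc (lookup-injective u e)

Unique⇒length≤ : ∀ {m} {xs : List (Fin m)} → Unique xs → length xs ≤ m
Unique⇒length≤ {m} {xs} u with length xs ≤? m
... | yes ≤m = ≤m
... | no  ≰m with pigeonhole (≰⇒> ≰m) (lookup xs)
...   | i , j , i<j , e = contradiction (lookup-injective u e) (<⇒≢ᶠ i<j)

Unique-++-∷⇒Unique-∷ : ∀ {x : A} {ys} xs → Unique (xs ++ x ∷ ys) → Unique (x ∷ xs)
Unique-++-∷⇒Unique-∷ []       _        = [] ∷ []
Unique-++-∷⇒Unique-∷ (a ∷ xs) (a∉ ∷ u) with Unique-++-∷⇒Unique-∷ xs u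
... | x∉xs ∷ u′ = (≢-sym (All.head (++⁻ʳ xs a∉)) ∷ x∉xs) ∷ (++⁻ˡ xs a∉ ∷ u′)

module _ {m} (T : Graph m) (acyclic : Acyclic T) where

  closedWalk⇒Cycle : ∀ {x a b} r → Unique (x ∷ a ∷ b ∷ r) → Linked (Edge T) (x ∷ a ∷ b ∷ r ++ [ x ]) → Cycle T
  closedWalk⇒Cycle {x} {a} {b} r u l = record
    { k     = length r
    ; c     = lookup (x ∷ a ∷ b ∷ r)
    ; inj   = lookup-injective u
    ; step  = Linked-lookup (Linked-++⁻ˡ (x ∷ a ∷ b ∷ r) l)
    ; close = Linked-last (a ∷ b ∷ r) l
    }

  nonBacktracking-no-return : ∀ {x} → Unique xs → Linked (Edge T) (x ∷ xs) → NonBacktracking (x ∷ xs) → x ∉ₗ xs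
  nonBacktracking-no-return {x = x} u l nb x∈xs with ∈-∃++ x∈xs
  ... | []        , _ , refl = Edge⇒≢ T (Linked.head l) refl
  ... | _ ∷ []    , _ , refl = proj₁ nb refl
  ... | a ∷ b ∷ r , _ , refl =
    acyclic (closedWalk⇒Cycle r (Unique-++-∷⇒Unique-∷ (a ∷ b ∷ r) u) (Linked-++-∷⁻ (x ∷ a ∷ b ∷ r) l))

  nonBacktracking⇒Unique : Linked (Edge T) xs → NonBacktracking xs → Unique xs
  nonBacktracking⇒Unique {xs = []}     _ _  = []
  nonBacktracking⇒Unique {xs = x ∷ xs} l nb = ¬Any⇒All¬ xs (nonBacktracking-no-return u l nb) ∷ u
    where
    u : Unique xs
    u = nonBacktracking⇒Unique (Linked.tail l) (NonBacktracking-tail xs nb)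

-- Tree decompositions

module _ {n} {G : Graph n} (D : TreeDecomposition G) where
  open TreeDecomposition D

  Walk : List (Fin m) → Set
  Walk ts = Linked (Edge tree) ts × NonBacktracking ts

  retrace-or-extend : ∀ {c d zs} → Walk (c ∷ zs) → Edge tree c d → (∃[ zs′ ] zs ≡ d ∷ zs′) ⊎ Walk (d ∷ c ∷ zs)
  retrace-or-extend {zs = []}             (l , _)  c—d = inj₂ (Edge-sym tree c—d ∷ l , tt)
  retrace-or-extend {d = d} {zs = r ∷ zs} (l , nb) c—d with d ≟ᶠ r
  ... | yes refl = inj₁ (zs , refl)
  ... | no  d≢r  = inj₂ (Edge-sym tree c—d ∷ l , d≢r , nb)

  Fresh : Fin n → List (Fin m) → Set
  Fresh v []      = ⊤
  Fresh v (s ∷ _) = v ∉ bag s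

  record Probe (v : Fin n) : Set where
    field
      {head}  : Fin m
      {trail} : List (Fin m)
      walk    : Walk (head ∷ trail)
      fresh   : Fresh v trail
      v∈head  : v ∈ bag head

    size : ℕ
    size = length (head ∷ trail)

  BagPath : Fin n → Fin m → Fin m → Set
  BagPath v = Star (λ s s′ → Edge tree s s′ × v ∈ bag s × v ∈ bag s′)

  -- A probe for v is prolonged along bags containing v until it reaches a bag containing y, cancelling
  -- backtracking steps on the way; it is then a probe for y.
  module Prolong {v y} (π : Probe v) (y∉head : y ∉ bag (Probe.head π)) where
    open Probe π using (head; trail; fresh)
    open Probe using (size)

    current : List (Fin m) → Fin m
    current []      = head
    current (c ∷ _) = c

    record Detour (seg : List (Fin m)) : Set where
      field
        walk  : Walk (seg ++ head ∷ trail)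
        v∈seg : All (λ s → v ∈ bag s) seg
        y∉seg : All (λ s → y ∉ bag s) (drop 1 seg)
    open Detour

    retreat : ∀ {c seg} → Detour (c ∷ seg) → Detour seg
    retreat {seg = seg} dt = record
      { walk  = Linked.tail (proj₁ (walk dt)) , NonBacktracking-tail (seg ++ head ∷ trail) (proj₂ (walk dt))
      ; v∈seg = All.tail (v∈seg dt)
      ; y∉seg = drop⁺ 1 (y∉seg dt)
      }

    advance : ∀ {d seg} → Detour seg → Walk (d ∷ seg ++ head ∷ trail) → v ∈ bag d → y ∉ bag (current seg) →
              Detour (d ∷ seg)
    advance {seg = []}    dt w v∈d _   = record { walk = w ; v∈seg = v∈d ∷ [] ; y∉seg = [] }
    advance {seg = _ ∷ _} dt w v∈d y∉c = record { walk = w ; v∈seg = v∈d ∷ v∈seg dt ; y∉seg = y∉c ∷ y∉seg dt }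

    current-++ : ∀ {d zs} seg → seg ++ head ∷ trail ≡ d ∷ zs → current seg ≡ d
    current-++ []      refl = refl
    current-++ (_ ∷ _) refl = refl

    step : ∀ {seg d} → Detour seg → Edge tree (current seg) d → v ∈ bag d → y ∉ bag (current seg) →
           ∃[ seg′ ] Detour seg′ × current seg′ ≡ d
    step {[]} dt c—d v∈d y∉c with retrace-or-extend (walk dt) c—d
    ... | inj₁ (_ , trail≡d∷) = contradiction v∈d (subst (Fresh v) trail≡d∷ fresh)
    ... | inj₂ w              = _ , advance dt w v∈d y∉c , refl
    step {c ∷ rest} dt c—d v∈d y∉c with retrace-or-extend (walk dt) c—d
    ... | inj₁ (_ , eq) = rest , retreat dt , current-++ rest eq
    ... | inj₂ w        = _ , advance dt w v∈d y∉c , refl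

    reach : ∀ {seg t} → Detour seg → BagPath v (current seg) t → y ∈ bag t →
            ∃[ seg′ ] Detour seg′ × y ∈ bag (current seg′)
    reach {seg} dt path y∈t with y ∈? bag (current seg)
    ... | yes y∈c = seg , dt , y∈c
    ... | no  y∉c with path
    ...   | ε = contradiction y∈t y∉c
    ...   | (c—d , _ , v∈d) ◅ path′ with step dt c—d v∈d y∉c
    ...     | _ , dt′ , refl = reach dt′ path′ y∈t

    exit : ∀ {seg} → Detour seg → y ∈ bag (current seg) → Σ (Probe y) λ π′ → size π < size π′
    exit {[]}       _  y∈head = contradiction y∈head y∉head
    exit {h ∷ rest} dt y∈h    =
      record { walk = walk dt ; fresh = fresh-y rest (y∉seg dt) ; v∈head = y∈h } , longer
      where
      fresh-y : ∀ rest → All (λ s → y ∉ bag s) rest → Fresh y (rest ++ head ∷ trail)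
      fresh-y []      _         = y∉head
      fresh-y (_ ∷ _) (y∉r ∷ _) = y∉r
      longer : length (head ∷ trail) < length (h ∷ rest ++ head ∷ trail)
      longer = s≤s (subst (length (head ∷ trail) ≤_) (sym (length-++ rest)) (m≤n+m _ (length rest)))

    prolong : ∀ {t} → BagPath v head t → y ∈ bag t → Σ (Probe y) λ π′ → size π < size π′
    prolong path y∈t with reach (record { walk = Probe.walk π ; v∈seg = [] ; y∉seg = [] }) path y∈t
    ... | _ , dt , y∈c = exit dt y∈c

  NeighboursIn : Subset n → Fin n → Fin m → Set
  NeighboursIn S x t = ∀ {y} → y ∈ S → Edge G x y → y ∈ bag t

  -- Probes are walks without backtracking, hence paths in the tree, so they cannot grow forever.
  search : ∀ {S v} fuel (π : Probe v) → m < Probe.size π + fuel → v ∈ S →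
           ∃[ x ] ∃[ t ] x ∈ S × x ∈ bag t × NeighboursIn S x t
  search zero π bound _ =
    contradiction (Unique⇒length≤ (uncurry (nonBacktracking⇒Unique tree (proj₂ isTree)) (Probe.walk π)))
                  (<⇒≱ (subst (m <_) (+-identityʳ _) bound))
  search {S} {v} (suc fuel) π bound v∈S
    with any? (λ y → y ∈? S ×-dec (Graph.adj G v y Bool.≟ true) ×-dec ¬? (y ∈? bag (Probe.head π)))
  ... | no none = v , Probe.head π , v∈S , Probe.v∈head π , in-head
    where
    in-head : NeighboursIn S v (Probe.head π)
    in-head {y} y∈S v—y with y ∈? bag (Probe.head π)
    ... | yes y∈head = y∈head
    ... | no  y∉head = contradiction (y , y∈S , v—y , y∉head) none
  ... | yes (y , y∈S , v—y , y∉head) with edgeCover v y v—y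
  ...   | t , v∈t , y∈t with Prolong.prolong π y∉head (coherent v (Probe.head π) t (Probe.v∈head π) v∈t) y∈t
  ...     | π′ , longer = search fuel π′ bound′ y∈S
    where
    bound′ : m < Probe.size π′ + fuel
    bound′ = <-≤-trans bound (subst (_≤ Probe.size π′ + fuel) (sym (+-suc _ fuel)) (+-monoˡ-≤ fuel longer))

  neighbourhood-in-bag : ∀ {S} → Nonempty S → ∃[ x ] ∃[ t ] x ∈ S × x ∈ bag t × NeighboursIn S x t
  neighbourhood-in-bag (x , x∈S) with vertexCover x
  ... | t , x∈t = search m (record { walk = [-] , tt ; fresh = tt ; v∈head = x∈t }) ≤-refl x∈S

-- Construction orders of 2-trees

module Ordering {n} (G : Graph n) where

  Attached : (ℕ → Fin n) → ℕ → Set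
  Attached ρ i = Σ ℕ λ j → Σ ℕ λ l → j < i × l < i × j ≢ l × Edge G (ρ j) (ρ l) ×
    (∀ p → p < i → (Edge G (ρ i) (ρ p) → p ≡ j ⊎ p ≡ l) × (p ≡ j ⊎ p ≡ l → Edge G (ρ i) (ρ p)))

  AttachedAt : Permutation′ n → Fin n → Set
  AttachedAt σ i = Σ (Fin n) λ j → Σ (Fin n) λ l →
    toℕ j < toℕ i × toℕ l < toℕ i × j ≢ l × Edge G (σ ⟨$⟩ʳ j) (σ ⟨$⟩ʳ l) ×
    (∀ p → toℕ p < toℕ i → (Edge G (σ ⟨$⟩ʳ i) (σ ⟨$⟩ʳ p) → p ≡ j ⊎ p ≡ l) ×
                           (p ≡ j ⊎ p ≡ l → Edge G (σ ⟨$⟩ʳ i) (σ ⟨$⟩ʳ p)))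

  Attached-cong : ∀ {ρ ρ′ : ℕ → Fin n} {i} → (∀ {j} → j ≤ i → ρ j ≡ ρ′ j) → Attached ρ i → Attached ρ′ i
  Attached-cong {ρ} {ρ′} {i} ρ≗ρ′ (j , l , j<i , l<i , j≢l , j—l , earlier) =
    j , l , j<i , l<i , j≢l , transport (<⇒≤ j<i) (<⇒≤ l<i) j—l ,
    λ p p<i → (λ i—p → proj₁ (earlier p p<i) (transport′ ≤-refl (<⇒≤ p<i) i—p)) ,
              (λ p∈jl → transport ≤-refl (<⇒≤ p<i) (proj₂ (earlier p p<i) p∈jl))
    where
    transport : ∀ {j l} → j ≤ i → l ≤ i → Edge G (ρ j) (ρ l) → Edge G (ρ′ j) (ρ′ l)
    transport j≤i l≤i = subst₂ (Edge G) (ρ≗ρ′ j≤i) (ρ≗ρ′ l≤i)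
    transport′ : ∀ {j l} → j ≤ i → l ≤ i → Edge G (ρ′ j) (ρ′ l) → Edge G (ρ j) (ρ l)
    transport′ j≤i l≤i = subst₂ (Edge G) (sym (ρ≗ρ′ j≤i)) (sym (ρ≗ρ′ l≤i))

  -- Is2Tree for the subgraph induced on S, with the construction order indexed by ℕ.
  record TwoTreeOrder (S : Subset n) (k : ℕ) : Set where
    field
      ρ           : ℕ → Fin n
      ρ∈S         : ∀ {i} → i < k → ρ i ∈ S
      ρ-injective : ∀ {i j} → i < k → j < k → ρ i ≡ ρ j → i ≡ j
      ρ-onto      : ∀ {z} → z ∈ S → ∃[ i ] i < k × ρ i ≡ z
      initial     : ∀ {i j} → i < 3 → j < 3 → i ≢ j → Edge G (ρ i) (ρ j)
      attached    : ∀ {i} → 3 ≤ i → i < k → Attached ρ i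

  data Below3 : ℕ → Set where
    #0 : Below3 0
    #1 : Below3 1
    #2 : Below3 2

  below3 : ∀ {i} → i < 3 → Below3 i
  below3 {0} _ = #0
  below3 {1} _ = #1
  below3 {2} _ = #2
  below3 {suc (suc (suc _))} (s≤s (s≤s (s≤s ())))

  triangle-order : ∀ {S a b c} → Edge G a b → Edge G a c → Edge G b c → a ∈ S → b ∈ S → c ∈ S →
                   (∀ {z} → z ∈ S → z ≡ a ⊎ z ≡ b ⊎ z ≡ c) → TwoTreeOrder S 3
  triangle-order {S} {a} {b} {c} a—b a—c b—c a∈S b∈S c∈S covered = record
    { ρ           = ρ
    ; ρ∈S         = λ i<3 → ∈S (below3 i<3)
    ; ρ-injective = injective
    ; ρ-onto      = onto ∘ covered
    ; initial     = λ i<3 j<3 → edge (below3 i<3) (below3 j<3)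
    ; attached    = λ 3≤i i<3 → contradiction 3≤i (<⇒≱ i<3)
    }
    where
    ρ : ℕ → Fin _
    ρ 0 = a
    ρ 1 = b
    ρ _ = c
    ∈S : ∀ {i} → Below3 i → ρ i ∈ S
    ∈S #0 = a∈S
    ∈S #1 = b∈S
    ∈S #2 = c∈S
    edge : ∀ {i j} → Below3 i → Below3 j → i ≢ j → Edge G (ρ i) (ρ j)
    edge #0 #0 0≢0 = contradiction refl 0≢0
    edge #0 #1 _   = a—b
    edge #0 #2 _   = a—c
    edge #1 #0 _   = Edge-sym G a—b
    edge #1 #1 1≢1 = contradiction refl 1≢1
    edge #1 #2 _   = b—c
    edge #2 #0 _   = Edge-sym G a—c
    edge #2 #1 _   = Edge-sym G b—c
    edge #2 #2 2≢2 = contradiction refl 2≢2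
    injective : ∀ {i j} → i < 3 → j < 3 → ρ i ≡ ρ j → i ≡ j
    injective {i} {j} i<3 j<3 ρi≡ρj with i ≟ j
    ... | yes i≡j = i≡j
    ... | no  i≢j = contradiction ρi≡ρj (Edge⇒≢ G (edge (below3 i<3) (below3 j<3) i≢j))
    onto : ∀ {z} → z ≡ a ⊎ z ≡ b ⊎ z ≡ c → ∃[ i ] i < 3 × ρ i ≡ z
    onto (inj₁ refl)        = 0 , s≤s z≤n , refl
    onto (inj₂ (inj₁ refl)) = 1 , s≤s (s≤s z≤n) , refl
    onto (inj₂ (inj₂ refl)) = 2 , ≤-refl , refl

  module Extend {S : Subset n} {k x a b} (order : TwoTreeOrder (S - x) k) (3≤k : 3 ≤ k)
                (x∈S : x ∈ S) (a∈S : a ∈ S) (b∈S : b ∈ S)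
                (x—a : Edge G x a) (x—b : Edge G x b) (a—b : Edge G a b)
                (neighbours : ∀ {y} → y ∈ S → Edge G x y → y ≡ a ⊎ y ≡ b) where
    open TwoTreeOrder order renaming (ρ to ρ₀; ρ∈S to ρ₀∈S-x; ρ-injective to ρ₀-injective;
                                      ρ-onto to ρ₀-onto; initial to initial₀; attached to attached₀)

    ρ : ℕ → Fin n
    ρ i with i ≟ k
    ... | yes _ = x
    ... | no  _ = ρ₀ i

    ρ-new : ρ k ≡ x
    ρ-new with k ≟ k
    ... | yes _   = refl
    ... | no  k≢k = contradiction refl k≢k

    ρ-old : ∀ {i} → i < k → ρ i ≡ ρ₀ i
    ρ-old {i} i<k with i ≟ k
    ... | yes refl = contradiction i<k (<-irrefl refl)
    ... | no  _    = refl

    ρ₀≢x : ∀ {i} → i < k → ρ₀ i ≢ x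
    ρ₀≢x i<k = x∈p-y⇒x≢y (ρ₀∈S-x i<k)

    index : ∀ {i} → i < suc k → i < k ⊎ i ≡ k
    index i<1+k = m≤n⇒m<n∨m≡n (≤-pred i<1+k)

    ρ∈S : ∀ {i} → i < suc k → ρ i ∈ S
    ρ∈S i<1+k with index i<1+k
    ... | inj₁ i<k  = subst (_∈ S) (sym (ρ-old i<k)) (x∈p-y⇒x∈p (ρ₀∈S-x i<k))
    ... | inj₂ refl = subst (_∈ S) (sym ρ-new) x∈S

    ρ-injective : ∀ {i j} → i < suc k → j < suc k → ρ i ≡ ρ j → i ≡ j
    ρ-injective i<1+k j<1+k ρi≡ρj with index i<1+k | index j<1+k
    ... | inj₁ i<k  | inj₁ j<k  = ρ₀-injective i<k j<k (trans (sym (ρ-old i<k)) (trans ρi≡ρj (ρ-old j<k)))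
    ... | inj₁ i<k  | inj₂ refl = contradiction (trans (sym (ρ-old i<k)) (trans ρi≡ρj ρ-new)) (ρ₀≢x i<k)
    ... | inj₂ refl | inj₁ j<k  = contradiction (trans (sym (ρ-old j<k)) (trans (sym ρi≡ρj) ρ-new)) (ρ₀≢x j<k)
    ... | inj₂ refl | inj₂ refl = refl

    ρ-onto : ∀ {z} → z ∈ S → ∃[ i ] i < suc k × ρ i ≡ z
    ρ-onto {z} z∈S with z ≟ᶠ x
    ... | yes refl = k , ≤-refl , ρ-new
    ... | no  z≢x with ρ₀-onto (x∈p∧x≢y⇒x∈p-y z∈S z≢x)
    ...   | i , i<k , ρ₀i≡z = i , m≤n⇒m≤1+n i<k , trans (ρ-old i<k) ρ₀i≡z

    initial : ∀ {i j} → i < 3 → j < 3 → i ≢ j → Edge G (ρ i) (ρ j)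
    initial i<3 j<3 i≢j = subst₂ (Edge G) (sym (ρ-old (<-≤-trans i<3 3≤k))) (sym (ρ-old (<-≤-trans j<3 3≤k)))
                            (initial₀ i<3 j<3 i≢j)

    index-of : ∀ {y} → y ∈ S → Edge G x y → ∃[ j ] j < k × ρ j ≡ y
    index-of y∈S x—y with ρ₀-onto (x∈p∧x≢y⇒x∈p-y y∈S (≢-sym (Edge⇒≢ G x—y)))
    ... | j , j<k , ρ₀j≡y = j , j<k , trans (ρ-old j<k) ρ₀j≡y

    attached-new : Attached ρ k
    attached-new with index-of a∈S x—a | index-of b∈S x—b
    ... | ja , ja<k , ρja≡a | jb , jb<k , ρjb≡b =
      ja , jb , ja<k , jb<k , (λ { refl → Edge⇒≢ G a—b (trans (sym ρja≡a) ρjb≡b) }) ,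
      subst₂ (Edge G) (sym ρja≡a) (sym ρjb≡b) a—b ,
      λ p p<k → to p<k , from
      where
      to : ∀ {p} → p < k → Edge G (ρ k) (ρ p) → p ≡ ja ⊎ p ≡ jb
      to {p} p<k x—ρp with neighbours (ρ∈S (m≤n⇒m≤1+n p<k)) (subst (λ z → Edge G z (ρ p)) ρ-new x—ρp)
      ... | inj₁ ρp≡a = inj₁ (ρ-injective (m≤n⇒m≤1+n p<k) (m≤n⇒m≤1+n ja<k) (trans ρp≡a (sym ρja≡a)))
      ... | inj₂ ρp≡b = inj₂ (ρ-injective (m≤n⇒m≤1+n p<k) (m≤n⇒m≤1+n jb<k) (trans ρp≡b (sym ρjb≡b)))
      from : ∀ {p} → p ≡ ja ⊎ p ≡ jb → Edge G (ρ k) (ρ p)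
      from (inj₁ refl) = subst₂ (Edge G) (sym ρ-new) (sym ρja≡a) x—a
      from (inj₂ refl) = subst₂ (Edge G) (sym ρ-new) (sym ρjb≡b) x—b

    attached : ∀ {i} → 3 ≤ i → i < suc k → Attached ρ i
    attached 3≤i i<1+k with index i<1+k
    ... | inj₁ i<k  = Attached-cong (λ j≤i → sym (ρ-old (≤-<-trans j≤i i<k))) (attached₀ 3≤i i<k)
    ... | inj₂ refl = attached-new

    extended : TwoTreeOrder S (suc k)
    extended = record { ρ = ρ ; ρ∈S = ρ∈S ; ρ-injective = ρ-injective ; ρ-onto = ρ-onto
                      ; initial = initial ; attached = attached }

  TwoTreeOrder⇒Is2Tree : 3 ≤ n → TwoTreeOrder Subset.⊤ n → Is2Tree G
  TwoTreeOrder⇒Is2Tree 3≤n order =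
    3≤n , σ , (λ i j i<3 j<3 i≢j → initial i<3 j<3 (i≢j ∘ toℕ-injective)) , attached′
    where
    open TwoTreeOrder order
    position : Fin n → Fin n
    position z = fromℕ< (proj₁ (proj₂ (ρ-onto {z} ∈⊤)))
    σ : Permutation′ n
    σ = permutation (ρ ∘ toℕ) position
          (λ z → trans (cong ρ (toℕ-fromℕ< _)) (proj₂ (proj₂ (ρ-onto ∈⊤))))
          (λ i → toℕ-injective (trans (toℕ-fromℕ< _)
                   (ρ-injective (proj₁ (proj₂ (ρ-onto ∈⊤))) (toℕ<n i) (proj₂ (proj₂ (ρ-onto ∈⊤))))))
    fin : ∀ {i j} → j < toℕ {n} i → ∃[ J ] toℕ J ≡ j
    fin {i} j<i = fromℕ< (<-trans j<i (toℕ<n i)) , toℕ-fromℕ< _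
    attached′ : ∀ i → 3 ≤ toℕ i → AttachedAt σ i
    attached′ i 3≤i with attached 3≤i (toℕ<n i)
    ... | j , l , j<i , l<i , j≢l , j—l , earlier with fin {i} j<i | fin {i} l<i
    ... | J , refl | L , refl =
      J , L , j<i , l<i , j≢l ∘ cong toℕ , j—l ,
      λ p p<i → Sum.map toℕ-injective toℕ-injective ∘ proj₁ (earlier (toℕ p) p<i) ,
                proj₂ (earlier (toℕ p) p<i) ∘ Sum.map (cong toℕ) (cong toℕ)

arc-exists : ∀ {n} {G : Graph n} (O : Orientation G) → 2 ≤ n → Connected G → ∃[ u ] ∃[ v ] Arc O u v
arc-exists {1}           O (s≤s ()) _
arc-exists {suc (suc _)} O _ connected with connected fzero (fsuc fzero)
... | _◅_ {j = y} 0—y _ with Orientation.edge⇒arc O fzero y 0—y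
...   | inj₁ 0→y = fzero , y , 0→y
...   | inj₂ y→0 = y , fzero , y→0

module Oriented {n} {G : Graph n} (O : Orientation G) where
  open Ordering G

  private variable
    S : Subset n
    C : Fin n → Set
    u v w : Fin n

  Arc⇒Edge : Arc O u v → Edge G u v
  Arc⇒Edge = Orientation.arc⇒edge O _ _

  Arc⇒≢ : Arc O u v → u ≢ v
  Arc⇒≢ u→v = Edge⇒≢ G (Arc⇒Edge u→v)

  Arc-asym : Arc O u v → ¬ Arc O v u
  Arc-asym = Orientation.antisym O _ _

  Arc? : ∀ u v → Dec (Arc O u v)
  Arc? u v = Orientation.arc O u v Bool.≟ true

  ConvexOn : Subset n → (Fin n → Set) → Set
  ConvexOn S C = ∀ {u v w} → Arc O u v → Arc O v w → u ∈ S → v ∈ S → w ∈ S → C u → C w → C v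

  -- The orientation induced on S is complete convex; convex sets are taken to be decidable predicates.
  CompleteConvexOn : Subset n → Set₁
  CompleteConvexOn S = ∀ {u v} → u ∈ S → v ∈ S → Arc O u v →
    ∀ (C : Fin n → Set) → Decidable C → ConvexOn S C → C u → C v → ∀ {x} → x ∈ S → C x

  CompleteConvex⇒CompleteConvexOn-⊤ : CompleteConvex O → CompleteConvexOn Subset.⊤
  CompleteConvex⇒CompleteConvexOn-⊤ cc {u} {v} _ _ u→v C C? convex Cu Cv {x} _ =
    ∈-toSubset⁻ C? (cc u v u→v x (toSubset C?) convex-set uv⊆C)
    where
    convex-set : Convex O (toSubset C?)
    convex-set _ _ _ _ _ p→c c→q p∈C q∈C =
      ∈-toSubset⁺ C? (convex p→c c→q ∈⊤ ∈⊤ ∈⊤ (∈-toSubset⁻ C? p∈C) (∈-toSubset⁻ C? q∈C))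
    uv⊆C : ⁅ u ⁆ ∪ ⁅ v ⁆ ⊆ toSubset C?
    uv⊆C {y} y∈uv with x∈p∪q⁻ ⁅ u ⁆ ⁅ v ⁆ y∈uv
    ... | inj₁ y∈u = ∈-toSubset⁺ C? (subst C (sym (x∈⁅y⁆⇒x≡y u y∈u)) Cu)
    ... | inj₂ y∈v = ∈-toSubset⁺ C? (subst C (sym (x∈⁅y⁆⇒x≡y v y∈v)) Cv)

  record Escape (S : Subset n) (C : Fin n → Set) : Set where
    field
      {p c q} : Fin n
      p→c     : Arc O p c
      c→q     : Arc O c q
      p∈S     : p ∈ S
      c∈S     : c ∈ S
      q∈S     : q ∈ S
      p∈C     : C p
      q∈C     : C q
      c∉C     : ¬ C c

  escape : CompleteConvexOn S → u ∈ S → v ∈ S → Arc O u v → Decidable C → C u → C v →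
           w ∈ S → ¬ C w → Escape S C
  escape {S} {C = C} cc u∈S v∈S u→v C? Cu Cv w∈S ¬Cw
    with any? (λ p → any? (λ c → any? (λ q →
           Arc? p c ×-dec Arc? c q ×-dec p ∈? S ×-dec c ∈? S ×-dec q ∈? S ×-dec
           C? p ×-dec C? q ×-dec ¬? (C? c))))
  ... | yes (_ , _ , _ , p→c , c→q , p∈S , c∈S , q∈S , Cp , Cq , ¬Cc) =
    record { p→c = p→c ; c→q = c→q ; p∈S = p∈S ; c∈S = c∈S ; q∈S = q∈S ; p∈C = Cp ; q∈C = Cq ; c∉C = ¬Cc }
  ... | no none = contradiction (cc u∈S v∈S u→v C C? convex Cu Cv w∈S) ¬Cw
    where
    convex : ConvexOn S C
    convex {p} {c} {q} p→c c→q p∈S c∈S q∈S Cp Cq with C? c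
    ... | yes Cc  = Cc
    ... | no  ¬Cc = contradiction (p , c , q , p→c , c→q , p∈S , c∈S , q∈S , Cp , Cq , ¬Cc) none

  record Ear (S : Subset n) : Set where
    field
      {x a b}    : Fin n
      x∈S        : x ∈ S
      a∈S        : a ∈ S
      b∈S        : b ∈ S
      a→x        : Arc O a x
      x→b        : Arc O x b
      b→a        : Arc O b a
      neighbours : ∀ {y} → y ∈ S → Edge G x y → y ≡ a ⊎ y ≡ b

  ArcAvoiding : Subset n → Fin n → Set
  ArcAvoiding S x = ∃[ u ] ∃[ v ] u ∈ S × v ∈ S × Arc O u v × u ≢ x × v ≢ x

  arc-avoiding-endpoint : ∀ {x} → CompleteConvexOn S → 3 ≤ ∣ S ∣ → u ∈ S → v ∈ S → Arc O u v →
                          x ≡ u ⊎ x ≡ v → ArcAvoiding S x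
  arc-avoiding-endpoint {S} {u} {v} {x} cc 3≤∣S∣ u∈S v∈S u→v x∈uv
    with 3≤∣p∣⇒third-element 3≤∣S∣ u∈S v∈S (Arc⇒≢ u→v)
  ... | w , w∈S , w≢u , w≢v = avoiding
    where
    open Escape (escape cc u∈S v∈S u→v (λ z → (z ≟ᶠ u) ⊎-dec (z ≟ᶠ v)) (inj₁ refl) (inj₂ refl)
                        w∈S [ w≢u , w≢v ]′)
    c≢x : c ≢ x
    c≢x refl = c∉C x∈uv
    avoiding : ArcAvoiding S x
    avoiding with p ≟ᶠ x
    ... | no  p≢x = p , c , p∈S , c∈S , p→c , p≢x , c≢x
    ... | yes p≡x = c , q , c∈S , q∈S , c→q , c≢x ,
                    λ q≡x → Arc-asym p→c (subst (Arc O c) (trans q≡x (sym p≡x)) c→q)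

  arc-avoiding : CompleteConvexOn S → 3 ≤ ∣ S ∣ → u ∈ S → v ∈ S → Arc O u v → ∀ x → ArcAvoiding S x
  arc-avoiding {u = u} {v} cc 3≤∣S∣ u∈S v∈S u→v x with u ≟ᶠ x | v ≟ᶠ x
  ... | no u≢x  | no v≢x  = u , v , u∈S , v∈S , u→v , u≢x , v≢x
  ... | yes u≡x | _       = arc-avoiding-endpoint cc 3≤∣S∣ u∈S v∈S u→v (inj₁ (sym u≡x))
  ... | no _    | yes v≡x = arc-avoiding-endpoint cc 3≤∣S∣ u∈S v∈S u→v (inj₂ (sym v≡x))

  dipath-through : ∀ {x} → CompleteConvexOn S → ArcAvoiding S x → x ∈ S →
                   ∃[ a ] ∃[ b ] a ∈ S × b ∈ S × Arc O a x × Arc O x b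
  dipath-through {x = x} cc (_ , _ , u∈S , v∈S , u→v , u≢x , v≢x) x∈S =
    p , q , p∈S , q∈S , subst (Arc O p) c≡x p→c , subst (λ z → Arc O z q) c≡x c→q
    where
    open Escape (escape cc u∈S v∈S u→v (λ z → ¬? (z ≟ᶠ x)) u≢x v≢x x∈S (λ x≢x → x≢x refl))
    c≡x : c ≡ x
    c≡x = decidable-stable (c ≟ᶠ x) c∉C

  closing-arc : ∀ {x a b} → CompleteConvexOn S → a ∈ S → x ∈ S → b ∈ S → Arc O a x → Arc O x b →
                (∀ {y} → y ∈ S → Edge G x y → y ≡ a ⊎ y ≡ b) → Arc O b a
  closing-arc {S} {x} {a} {b} cc a∈S x∈S b∈S a→x x→b neighbours = close p∈C q∈C c∉C p→c c→q c∈S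
    where
    b∉ax : ¬ (b ≡ a ⊎ b ≡ x)
    b∉ax = [ (λ b≡a → Arc-asym a→x (subst (Arc O x) b≡a x→b)) , (λ b≡x → Arc⇒≢ x→b (sym b≡x)) ]′
    open Escape (escape cc a∈S x∈S a→x (λ z → (z ≟ᶠ a) ⊎-dec (z ≟ᶠ x)) (inj₁ refl) (inj₂ refl) b∈S b∉ax)
    close : ∀ {p c q} → p ≡ a ⊎ p ≡ x → q ≡ a ⊎ q ≡ x → ¬ (c ≡ a ⊎ c ≡ x) →
            Arc O p c → Arc O c q → c ∈ S → Arc O b a
    close (inj₁ refl) (inj₁ refl) _ p→c c→q _ = contradiction c→q (Arc-asym p→c)
    close (inj₂ refl) (inj₂ refl) _ p→c c→q _ = contradiction c→q (Arc-asym p→c)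
    close (inj₁ refl) (inj₂ refl) c∉ _ c→x c∈S with neighbours c∈S (Edge-sym G (Arc⇒Edge c→x))
    ... | inj₁ c≡a  = contradiction (inj₁ c≡a) c∉
    ... | inj₂ refl = contradiction c→x (Arc-asym x→b)
    close (inj₂ refl) (inj₁ refl) c∉ x→c c→a c∈S with neighbours c∈S (Arc⇒Edge x→c)
    ... | inj₁ c≡a  = contradiction (inj₁ c≡a) c∉
    ... | inj₂ refl = c→a

  Cyclic : Fin n → Fin n → Fin n → Set
  Cyclic p q r = Arc O p q × Arc O q r × Arc O r p

  DirectedTriangle : Fin n → Fin n → Fin n → Set
  DirectedTriangle p q r = Cyclic p q r ⊎ Cyclic p r q

  TrianglesDirectedOn : Subset n → Set
  TrianglesDirectedOn S = ∀ {p q r} → p ∈ S → q ∈ S → r ∈ S →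
    Edge G p q → Edge G q r → Edge G p r → DirectedTriangle p q r

  DirectedTriangle-rotate : ∀ {p q r} → DirectedTriangle p q r → DirectedTriangle q r p
  DirectedTriangle-rotate (inj₁ (p→q , q→r , r→p)) = inj₁ (q→r , r→p , p→q)
  DirectedTriangle-rotate (inj₂ (p→r , r→q , q→p)) = inj₂ (q→p , p→r , r→q)

  module _ {S} (e : Ear S) where
    open Ear e

    private
      x—a : Edge G x a
      x—a = Edge-sym G (Arc⇒Edge a→x)
      x—b : Edge G x b
      x—b = Arc⇒Edge x→b
      a—b : Edge G a b
      a—b = Edge-sym G (Arc⇒Edge b→a)

    ∣S-x∣≡ : ∀ {k} → ∣ S ∣ ≡ suc k → ∣ S - x ∣ ≡ k
    ∣S-x∣≡ ∣S∣≡1+k = suc-injective (trans (sym (∣p∣≡1+∣p-x∣ x∈S)) ∣S∣≡1+k)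

    a∈S-x : a ∈ S - x
    a∈S-x = x∈p∧x≢y⇒x∈p-y a∈S (Arc⇒≢ a→x)

    b∈S-x : b ∈ S - x
    b∈S-x = x∈p∧x≢y⇒x∈p-y b∈S (≢-sym (Arc⇒≢ x→b))

    -- C is enlarged to a set convex on S by letting it contain x exactly when it contains both neighbours
    -- of x.
    CompleteConvexOn-remove : CompleteConvexOn S → CompleteConvexOn (S - x)
    CompleteConvexOn-remove cc u∈S-x v∈S-x u→v C C? convex Cu Cv z∈S-x =
      proj₂ (cc (x∈p-y⇒x∈p u∈S-x) (x∈p-y⇒x∈p v∈S-x) u→v C′ C′? convex′ (C′-intro u∈S-x Cu) (C′-intro v∈S-x Cv)
                (x∈p-y⇒x∈p z∈S-x))
            (x∈p-y⇒x≢y z∈S-x)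
      where
      C′ : Fin n → Set
      C′ z = (z ≡ x → C a × C b) × (z ≢ x → C z)
      C′? : Decidable C′
      C′? z = ((z ≟ᶠ x) →-dec (C? a ×-dec C? b)) ×-dec (¬? (z ≟ᶠ x) →-dec C? z)
      C′-intro : ∀ {z} → z ∈ S - x → C z → C′ z
      C′-intro z∈S-x Cz = (λ z≡x → contradiction z≡x (x∈p-y⇒x≢y z∈S-x)) , (λ _ → Cz)
      neighbour∈C : ∀ {c} → C a × C b → c ≡ a ⊎ c ≡ b → C c
      neighbour∈C (Ca , _)  (inj₁ refl) = Ca
      neighbour∈C (_  , Cb) (inj₂ refl) = Cb
      in-neighbour : ∀ {p} → p ∈ S → Arc O p x → p ≡ a
      in-neighbour p∈S p→x with neighbours p∈S (Edge-sym G (Arc⇒Edge p→x))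
      ... | inj₁ p≡a  = p≡a
      ... | inj₂ refl = contradiction p→x (Arc-asym x→b)
      out-neighbour : ∀ {q} → q ∈ S → Arc O x q → q ≡ b
      out-neighbour q∈S x→q with neighbours q∈S (Arc⇒Edge x→q)
      ... | inj₁ refl = contradiction x→q (Arc-asym a→x)
      ... | inj₂ q≡b  = q≡b
      convex′ : ConvexOn S C′
      convex′ {p} {c} {q} p→c c→q p∈S c∈S q∈S C′p C′q with c ≟ᶠ x
      ... | yes refl = (λ _ → subst C (in-neighbour p∈S p→c) (proj₂ C′p (Arc⇒≢ p→c)) ,
                              subst C (out-neighbour q∈S c→q) (proj₂ C′q (≢-sym (Arc⇒≢ c→q)))) ,
                       (λ x≢x → contradiction refl x≢x)
      ... | no c≢x = (λ c≡x → contradiction c≡x c≢x) , (λ _ → Cc)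
        where
        Cc : C c
        Cc with p ≟ᶠ x | q ≟ᶠ x
        ... | yes refl | _        = neighbour∈C (proj₁ C′p refl) (neighbours c∈S (Arc⇒Edge p→c))
        ... | no _     | yes refl = neighbour∈C (proj₁ C′q refl) (neighbours c∈S (Edge-sym G (Arc⇒Edge c→q)))
        ... | no p≢x   | no q≢x   = convex p→c c→q (x∈p∧x≢y⇒x∈p-y p∈S p≢x) (x∈p∧x≢y⇒x∈p-y c∈S c≢x)
                                      (x∈p∧x≢y⇒x∈p-y q∈S q≢x) (proj₂ C′p p≢x) (proj₂ C′q q≢x)

    triangle-at-ear : ∀ {q r} → q ∈ S → r ∈ S → Edge G x q → Edge G q r → Edge G x r → DirectedTriangle x q r
    triangle-at-ear q∈S r∈S x—q q—r x—r with neighbours q∈S x—q | neighbours r∈S x—r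
    ... | inj₁ refl | inj₁ refl = contradiction refl (Edge⇒≢ G q—r)
    ... | inj₁ refl | inj₂ refl = inj₂ (x→b , b→a , a→x)
    ... | inj₂ refl | inj₁ refl = inj₁ (x→b , b→a , a→x)
    ... | inj₂ refl | inj₂ refl = contradiction refl (Edge⇒≢ G q—r)

    TrianglesDirectedOn-extend : TrianglesDirectedOn (S - x) → TrianglesDirectedOn S
    TrianglesDirectedOn-extend directed {p} {q} {r} p∈S q∈S r∈S p—q q—r p—r with p ≟ᶠ x | q ≟ᶠ x | r ≟ᶠ x
    ... | yes refl | _        | _        = triangle-at-ear q∈S r∈S p—q q—r p—r
    ... | no _     | yes refl | _        = DirectedTriangle-rotate (DirectedTriangle-rotate
                                             (triangle-at-ear r∈S p∈S q—r (Edge-sym G p—r) (Edge-sym G p—q)))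
    ... | no _     | no _     | yes refl = DirectedTriangle-rotate
                                             (triangle-at-ear p∈S q∈S (Edge-sym G p—r) p—q (Edge-sym G q—r))
    ... | no p≢x   | no q≢x   | no r≢x   =
      directed (x∈p∧x≢y⇒x∈p-y p∈S p≢x) (x∈p∧x≢y⇒x∈p-y q∈S q≢x) (x∈p∧x≢y⇒x∈p-y r∈S r≢x) p—q q—r p—r

    -- S - x has only two vertices, so it contains no triangle.
    TrianglesDirectedOn-small : ∣ S ∣ ≤ 3 → TrianglesDirectedOn (S - x)
    TrianglesDirectedOn-small ∣S∣≤3 p∈S-x q∈S-x r∈S-x p—q q—r p—r = contradiction ∣S∣≤3 (<⇒≱
      (four-elements⇒4≤∣p∣ (x∈p-y⇒x∈p p∈S-x) (x∈p-y⇒x∈p q∈S-x) (x∈p-y⇒x∈p r∈S-x) x∈S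
        (Edge⇒≢ G p—q) (Edge⇒≢ G p—r) (x∈p-y⇒x≢y p∈S-x) (Edge⇒≢ G q—r) (x∈p-y⇒x≢y q∈S-x) (x∈p-y⇒x≢y r∈S-x)))

    TwoTreeOrder-small : ∣ S ∣ ≤ 3 → TwoTreeOrder S 3
    TwoTreeOrder-small ∣S∣≤3 = triangle-order a—b (Edge-sym G x—a) (Edge-sym G x—b) a∈S b∈S x∈S
      (∣p∣≤3⇒one-of-three ∣S∣≤3 a∈S b∈S x∈S (Edge⇒≢ G a—b) (≢-sym (Edge⇒≢ G x—a)) (≢-sym (Edge⇒≢ G x—b)))

    TwoTreeOrder-extend : ∀ {k} → TwoTreeOrder (S - x) k → 3 ≤ k → TwoTreeOrder S (suc k)
    TwoTreeOrder-extend order 3≤k = Extend.extended order 3≤k x∈S a∈S b∈S x—a x—b a—b neighbours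

  module _ (D : TreeDecomposition G) (width : HasWidthAtMost D 2) where
    open TreeDecomposition D using (bag)

    ear : CompleteConvexOn S → 3 ≤ ∣ S ∣ → u ∈ S → v ∈ S → Arc O u v → Ear S
    ear {S} cc 3≤∣S∣ u∈S v∈S u→v with neighbourhood-in-bag D (_ , u∈S)
    ... | x , t , x∈S , x∈t , in-t with dipath-through cc (arc-avoiding cc 3≤∣S∣ u∈S v∈S u→v x) x∈S
    ... | a , b , a∈S , b∈S , a→x , x→b = record
      { x∈S = x∈S ; a∈S = a∈S ; b∈S = b∈S ; a→x = a→x ; x→b = x→b
      ; b→a = closing-arc cc a∈S x∈S b∈S a→x x→b neighbours
      ; neighbours = neighbours
      }
      where
      a≢b : a ≢ b
      a≢b a≡b = Arc-asym a→x (subst (Arc O x) (sym a≡b) x→b)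
      neighbours : ∀ {y} → y ∈ S → Edge G x y → y ≡ a ⊎ y ≡ b
      neighbours y∈S x—y
        with ∣p∣≤3⇒one-of-three (width t) x∈t (in-t a∈S (Edge-sym G (Arc⇒Edge a→x))) (in-t b∈S (Arc⇒Edge x→b))
               (≢-sym (Arc⇒≢ a→x)) (Arc⇒≢ x→b) a≢b (in-t y∈S x—y)
      ... | inj₁ y≡x  = contradiction (sym y≡x) (Edge⇒≢ G x—y)
      ... | inj₂ y∈ab = y∈ab

    peel : ∀ j {S} → ∣ S ∣ ≡ 3 + j → CompleteConvexOn S → u ∈ S → v ∈ S → Arc O u v →
           TwoTreeOrder S (3 + j) × TrianglesDirectedOn S
    peel zero {S} ∣S∣≡3 cc u∈S v∈S u→v with ear cc (≤-reflexive (sym ∣S∣≡3)) u∈S v∈S u→v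
    ... | e = TwoTreeOrder-small e ∣S∣≤3 , TrianglesDirectedOn-extend e (TrianglesDirectedOn-small e ∣S∣≤3)
      where
      ∣S∣≤3 : ∣ S ∣ ≤ 3
      ∣S∣≤3 = ≤-reflexive ∣S∣≡3
    peel (suc j) ∣S∣≡4+j cc u∈S v∈S u→v
      with ear cc (subst (3 ≤_) (sym ∣S∣≡4+j) (s≤s (s≤s (s≤s z≤n)))) u∈S v∈S u→v
    ... | e with peel j (∣S-x∣≡ e ∣S∣≡4+j) (CompleteConvexOn-remove e cc) (b∈S-x e) (a∈S-x e) (Ear.b→a e)
    ...   | order , directed =
      TwoTreeOrder-extend e order (s≤s (s≤s (s≤s z≤n))) , TrianglesDirectedOn-extend e directed

  forward : TreeWidth≤ G 2 → 3 ≤ n → Connected G → CompleteConvex O → Is2Tree G × TrianglesDirected O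
  forward (D , width) 3≤n connected cc with arc-exists O (≤-trans (n≤1+n 2) 3≤n) connected
  ... | u , v , u→v with peel D width (n ∸ 3) (trans (∣⊤∣≡n n) (sym (m+[n∸m]≡n 3≤n)))
                              (CompleteConvex⇒CompleteConvexOn-⊤ cc) ∈⊤ ∈⊤ u→v
  ...   | order , directed =
    TwoTreeOrder⇒Is2Tree 3≤n (subst (TwoTreeOrder Subset.⊤) (m+[n∸m]≡n 3≤n) order) ,
    λ _ _ _ → directed ∈⊤ ∈⊤ ∈⊤

-- Convexity in 2-trees

module Backward {n} {G : Graph n} (O : Orientation G) (directed : TrianglesDirected O)
                (σ : Permutation′ n)
                (initial : ∀ i j → toℕ i < 3 → toℕ j < 3 → i ≢ j → Edge G (σ ⟨$⟩ʳ i) (σ ⟨$⟩ʳ j))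
                (attached : ∀ i → 3 ≤ toℕ i → Ordering.AttachedAt G σ i)
                {C : Subset n} (convex : Convex O C) where
  open Oriented O using (Arc⇒≢)

  triangle-closure : ∀ {y z w} → Edge G y z → Edge G w y → Edge G w z → y ∈ C → z ∈ C → w ∈ C
  triangle-closure {y} {z} {w} y—z w—y w—z y∈C z∈C with directed w y z w—y y—z w—z
  ... | inj₁ (w→y , _ , z→w) = convex z w y (Arc⇒≢ z→w) (Arc⇒≢ w→y) z→w w→y z∈C y∈C
  ... | inj₂ (w→z , _ , y→w) = convex y w z (Arc⇒≢ y→w) (Arc⇒≢ w→z) y→w w→z y∈C z∈C

  InitialIn : Set
  InitialIn = ∀ {k} → toℕ k < 3 → σ ⟨$⟩ʳ k ∈ C

  initial-closure : ∀ {i j} → toℕ i < 3 → toℕ j < 3 → i ≢ j → σ ⟨$⟩ʳ i ∈ C → σ ⟨$⟩ʳ j ∈ C → InitialIn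
  initial-closure {i} {j} i<3 j<3 i≢j σi∈C σj∈C {k} k<3 with k ≟ᶠ i | k ≟ᶠ j
  ... | yes refl | _        = σi∈C
  ... | no _     | yes refl = σj∈C
  ... | no k≢i   | no k≢j   =
    triangle-closure (initial i j i<3 j<3 i≢j) (initial k i k<3 i<3 k≢i) (initial k j k<3 j<3 k≢j) σi∈C σj∈C

  descend : ∀ f {i j} → toℕ i < f → toℕ j < f → i ≢ j → Edge G (σ ⟨$⟩ʳ i) (σ ⟨$⟩ʳ j) →
            σ ⟨$⟩ʳ i ∈ C → σ ⟨$⟩ʳ j ∈ C → InitialIn
  descend-from : ∀ f {i j} → toℕ i < suc f → toℕ j < toℕ i → Edge G (σ ⟨$⟩ʳ i) (σ ⟨$⟩ʳ j) →
                 σ ⟨$⟩ʳ i ∈ C → σ ⟨$⟩ʳ j ∈ C → InitialIn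

  descend (suc f) {i} {j} i<1+f j<1+f i≢j i—j σi∈C σj∈C with <-cmp (toℕ i) (toℕ j)
  ... | tri< i<j _ _ = descend-from f j<1+f i<j (Edge-sym G i—j) σj∈C σi∈C
  ... | tri≈ _ i≡j _ = contradiction (toℕ-injective i≡j) i≢j
  ... | tri> _ _ j<i = descend-from f i<1+f j<i i—j σi∈C σj∈C

  -- The later end i is attached to an earlier edge j o; the triangle i j o brings o into C, and the edge
  -- j o lies strictly before i.
  descend-from f {i} {j} i<1+f j<i i—j σi∈C σj∈C with 3 ≤? toℕ i
  ... | no  i≱3 = initial-closure (≰⇒> i≱3) (<-trans j<i (≰⇒> i≱3)) (λ { refl → <-irrefl refl j<i }) σi∈C σj∈C
  ... | yes 3≤i with attached i 3≤i
  ...   | jj , ll , jj<i , ll<i , jj≢ll , jj—ll , earlier with other (proj₁ (earlier j j<i) i—j)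
    where
    other : j ≡ jj ⊎ j ≡ ll →
            ∃[ o ] toℕ o < toℕ i × j ≢ o × Edge G (σ ⟨$⟩ʳ j) (σ ⟨$⟩ʳ o) × Edge G (σ ⟨$⟩ʳ i) (σ ⟨$⟩ʳ o)
    other (inj₁ refl) = ll , ll<i , jj≢ll , jj—ll , proj₂ (earlier ll ll<i) (inj₂ refl)
    other (inj₂ refl) = jj , jj<i , ≢-sym jj≢ll , Edge-sym G jj—ll , proj₂ (earlier jj jj<i) (inj₁ refl)
  ...     | o , o<i , j≢o , j—o , i—o =
    descend f (≤-trans j<i (≤-pred i<1+f)) (≤-trans o<i (≤-pred i<1+f)) j≢o j—o σj∈C
      (triangle-closure i—j (Edge-sym G i—o) (Edge-sym G j—o) σi∈C σj∈C)

  climb : ∀ f {i} → toℕ i < f → InitialIn → σ ⟨$⟩ʳ i ∈ C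
  climb (suc f) {i} i<1+f initial∈C with 3 ≤? toℕ i
  ... | no  i≱3 = initial∈C (≰⇒> i≱3)
  ... | yes 3≤i with attached i 3≤i
  ...   | jj , ll , jj<i , ll<i , _ , jj—ll , earlier =
    triangle-closure jj—ll (proj₂ (earlier jj jj<i) (inj₁ refl)) (proj₂ (earlier ll ll<i) (inj₂ refl))
      (climb f (≤-trans jj<i (≤-pred i<1+f)) initial∈C) (climb f (≤-trans ll<i (≤-pred i<1+f)) initial∈C)

backward : ∀ {n} {G : Graph n} (O : Orientation G) → Is2Tree G → TrianglesDirected O → CompleteConvex O
backward {n} {G} O (_ , σ , initial , attached) directed u v u→v x C convex uv⊆C =
  subst (_∈ C) (inverseʳ σ)
    (climb n (toℕ<n _) (descend n (toℕ<n _) (toℕ<n _) i≢j i—j (σ-in-C u∈C) (σ-in-C v∈C)))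
  where
  open Backward O directed σ initial attached convex
  open Oriented O using (Arc⇒Edge; Arc⇒≢)
  u∈C : u ∈ C
  u∈C = uv⊆C (x∈p∪q⁺ (inj₁ (x∈⁅x⁆ u)))
  v∈C : v ∈ C
  v∈C = uv⊆C (x∈p∪q⁺ (inj₂ (x∈⁅x⁆ v)))
  σ-in-C : ∀ {z} → z ∈ C → σ ⟨$⟩ʳ (σ ⟨$⟩ˡ z) ∈ C
  σ-in-C = subst (_∈ C) (sym (inverseʳ σ))
  i≢j : σ ⟨$⟩ˡ u ≢ σ ⟨$⟩ˡ v
  i≢j i≡j = Arc⇒≢ u→v (trans (sym (inverseʳ σ)) (trans (cong (σ ⟨$⟩ʳ_) i≡j) (inverseʳ σ)))
  i—j : Edge G (σ ⟨$⟩ʳ (σ ⟨$⟩ˡ u)) (σ ⟨$⟩ʳ (σ ⟨$⟩ˡ v))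
  i—j = subst₂ (Edge G) (sym (inverseʳ σ)) (sym (inverseʳ σ)) (Arc⇒Edge u→v)

theorem8 : ∀ {n : ℕ} (T : Graph n) → 2 ≤ n → Connected T → TreeWidth≡ T 2 →
    (O : Orientation T) → CompleteConvex O ⇔ (Is2Tree T × TrianglesDirected O)
theorem8 T 2≤n connected (width≤2 , width≰1) O =
  mk⇔ (Oriented.forward O width≤2 (treeWidth≰1⇒3≤n T 2≤n width≰1) connected) (uncurry (backward O))
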